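{- Let $F=x^{ -1}+1+x+y^{ -1}+y\in\mathrm{GF}(2)[x,x^{ -1},y,y^{ -1}]$ (the von Neumann neighborhood in $\mathbb{Z}^2$ together with its center). For $n\ge0$ let $b_n=|F^{2^n-1}|$, the number of ON cells at generation $2^n-1$ of the odd-rule cellular automaton with neighborhood $F$ started from a single ON cell at the origin. Then $b_0=1$, $b_1=5$, and $b_{n+1}=3b_n+2b_{n-1}$ for all $n\ge1$.
   Context: For a Laurent polynomial $P$ with coefficients in $\mathrm{GF}(2)$, $|P|$ denotes the number of its nonzero terms. In the odd-rule CA with neighborhood $F$, a cell $u\in\mathbb{Z}^2$ is identified with the monomial $x^{u_1}y^{u_2}$, the neighborhood of cell $w$ is $x^{w_1}y^{w_2}F$, and a cell is ON at generation $n+1$ iff it lies in the neighborhoods of an odd number of cells that are ON at generation $n$; the state at generation $m$ is $F^m$. -}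

module Defs where

open import Data.Bool using (Bool; true; false; _xor_; if_then_else_)
open import Data.Nat using (ℕ; zero; suc; _^_; _∸_)
open import Data.Integer using (ℤ; +_; -[1+_]) renaming (_+_ to _+ℤ_)
open import Data.Product using (_×_; _,_)
open import Data.List using (List; []; _∷_; map; concatMap; filter; length; deduplicate)
open import Data.Product.Properties using (≡-dec)
import Data.Integer.Properties as ℤP
open import Relation.Nullary.Decidable using (does)
open import Relation.Binary.PropositionalEquality using (_≡_)
open import Relation.Binary.Definitions using (DecidableEquality)

-- Laurent polynomials over GF(2) in two variables x, y.
-- A monomial x^a y^b is its exponent vector (a , b) ∈ ℤ², i.e. a cell of ℤ².
Cell : Set
Cell = ℤ × ℤ

_≟c_ : DecidableEquality Cell
_≟c_ = ≡-dec ℤP._≟_ ℤP._≟_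

-- A polynomial is represented by a finite list of monomials (a formal sum);
-- the coefficient (in GF(2)) of a monomial is the parity of its multiplicity.
Poly : Set
Poly = List Cell

coeff : Poly → Cell → Bool
coeff [] u = false
coeff (v ∷ P) u = (does (v ≟c u)) xor coeff P u

_*P_ : Poly → Poly → Poly
P *P Q = concatMap (λ { (a , b) → map (λ { (c , d) → (a +ℤ c , b +ℤ d) }) Q }) P

one : Poly
one = (+ 0 , + 0) ∷ []

_^P_ : Poly → ℕ → Poly
P ^P zero = one
P ^P suc m = P *P (P ^P m)

support : Poly → List Cell
support P = filter (λ u → coeff P u ≟b true) (deduplicate _≟c_ P)
  where
  open import Data.Bool.Properties renaming (_≟_ to _≟b_)

∣_∣P : Poly → ℕ
∣ P ∣P = length (support P)

F : Poly
F = (-[1+ 0 ] , + 0) ∷ (+ 0 , + 0) ∷ (+ 1 , + 0) ∷ (+ 0 , -[1+ 0 ]) ∷ (+ 0 , + 1) ∷ []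

b : ℕ → ℕ
b n = ∣ F ^P (2 ^ n ∸ 1) ∣P

-- Over GF(2), P² = P(x², y²); hence F^(2k+1) = F · G(x², y²) with G = F^k.
-- Splitting F (or a multiple Q·F) by the parity class of its exponents,
-- Q·F = Σ_κ x^κ Q_κ(x², y²), the four summands x^κ (Q_κ G)(x², y²) live on
-- disjoint cosets of 2ℤ², whence |Q·F·G(x², y²)| = Σ_κ |Q_κ G|.  Taking
-- Q = 1, 1 + x, 1 + y gives a closed linear system for the counts
-- b_n = |G_n|, c_n = |(1 + x) G_n|, d_n = |(1 + y) G_n| with G_n = F^(2^n - 1):
--   b_{n+1} = b_n + c_n + d_n,  c_{n+1} = 2 b_n + 2 d_n,  d_{n+1} = 2 b_n + 2 c_n,
-- and eliminating c and d yields b_{n+2} = 3 b_{n+1} + 2 b_n.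
module Submission where

open import Defs
open import Algebra.Bundles using (CommutativeRing; AbelianGroup)
open import Data.Bool using (Bool; true; false; _xor_)
open import Data.Bool.Properties using (xor-assoc; xor-same; xor-identityʳ; xor-∧-commutativeRing)
open import Data.Integer using (ℤ; +_; -[1+_]; _-_) renaming (_+_ to _+ℤ_)
import Data.Integer.Properties as ℤ
open import Data.List using (List; []; _∷_; _++_; map; concatMap; length; deduplicate)
open import Data.Nat.ListAction using (sum)
open import Data.List.Properties using (length-map; length-++) renaming (map-cong to map-cong-≡)
open import Data.List.Membership.Propositional using (_∈_; _∉_)
open import Data.List.Membership.Propositional.Properties
  using (∈-map⁺; ∈-map⁻; ∈-++⁺ˡ; ∈-++⁺ʳ; ∈-++⁻; ∈-filter⁺; ∈-filter⁻; ∈-deduplicate⁺)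
open import Data.List.Membership.Propositional.Properties.WithK using (unique∧set⇒bag)
open import Data.List.Relation.Binary.BagAndSetEquality using (∼bag⇒↭)
open import Data.List.Relation.Binary.Disjoint.Propositional using (Disjoint)
open import Data.List.Relation.Binary.Permutation.Propositional.Properties using (↭-length)
open import Data.List.Relation.Unary.All using (All; []; _∷_)
open import Data.List.Relation.Unary.Any using (here; there)
open import Data.List.Relation.Unary.AllPairs using ([]; _∷_)
open import Data.List.Relation.Unary.Unique.Propositional using (Unique)
import Data.List.Relation.Unary.Unique.Propositional.Properties as Unique
open import Data.List.Relation.Unary.Unique.DecPropositional.Properties _≟c_ using (deduplicate-!)
open import Data.Nat using (ℕ; zero; suc; _+_; _*_; _^_; _∸_; NonZero)
open import Data.Nat.Properties using (+-identityʳ; +-suc; suc-injective; m^n≢0)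
open import Data.Nat.Tactic.RingSolver using (solve-∀)
open import Data.Integer.Tactic.RingSolver using () renaming (solve-∀ to solveℤ-∀)
open import Data.Product using (_×_; _,_; proj₁; proj₂; ∃-syntax)
open import Data.Sum using (inj₁; inj₂)
open import Function using (_∘_; _⇔_; mk⇔; Equivalence)
open import Level using (0ℓ)
open import Relation.Binary using (Setoid; tri<; tri≈; tri>)
open import Relation.Binary.PropositionalEquality
open import Relation.Nullary using (yes; no; does; contradiction)
open import Relation.Nullary.Decidable using (dec-true; dec-false)
import Algebra.Properties.CommutativeSemigroup as CommutativeSemigroupProperties
import Algebra.Properties.Group as GroupProperties
import Relation.Binary.Reasoning.Setoid as SetoidReasoning

infixl 6 _+ᶜ_

_+ᶜ_ : Cell → Cell → Cell
(a , b) +ᶜ (c , d) = a +ℤ c , b +ℤ d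

0ᶜ : Cell
0ᶜ = + 0 , + 0

double : Cell → Cell
double u = u +ᶜ u

+ᶜ-assoc : ∀ u v w → u +ᶜ v +ᶜ w ≡ u +ᶜ (v +ᶜ w)
+ᶜ-assoc (a , b) (c , d) (e , f) = cong₂ _,_ (ℤ.+-assoc a c e) (ℤ.+-assoc b d f)

+ᶜ-comm : ∀ u v → u +ᶜ v ≡ v +ᶜ u
+ᶜ-comm (a , b) (c , d) = cong₂ _,_ (ℤ.+-comm a c) (ℤ.+-comm b d)

+ᶜ-identityˡ : ∀ u → 0ᶜ +ᶜ u ≡ u
+ᶜ-identityˡ (a , b) = cong₂ _,_ (ℤ.+-identityˡ a) (ℤ.+-identityˡ b)

+ᶜ-cancelˡ : ∀ u {v w} → u +ᶜ v ≡ u +ᶜ w → v ≡ w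
+ᶜ-cancelˡ (a , b) e = cong₂ _,_ (cancel a _ _ (cong proj₁ e)) (cancel b _ _ (cong proj₂ e))
  where open GroupProperties (AbelianGroup.group ℤ.+-0-abelianGroup) renaming (∙-cancelˡ to cancel)

double-+ᶜ : ∀ u v → double (u +ᶜ v) ≡ double u +ᶜ double v
double-+ᶜ (a , b) (c , d) = cong₂ _,_ (interchange a c a c) (interchange b d b d)
  where open CommutativeSemigroupProperties ℤ.+-commutativeSemigroup using (interchange)

doubleℤ-injective : ∀ {a c : ℤ} → a +ℤ a ≡ c +ℤ c → a ≡ c
doubleℤ-injective {a} {c} e with ℤ.<-cmp a c
... | tri< a<c _ _ = contradiction e (ℤ.<⇒≢ (ℤ.+-mono-< a<c a<c))
... | tri≈ _ a≡c _ = a≡c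
... | tri> _ _ c<a = contradiction (sym e) (ℤ.<⇒≢ (ℤ.+-mono-< c<a c<a))

double-injective : ∀ {u v} → double u ≡ double v → u ≡ v
double-injective e = cong₂ _,_ (doubleℤ-injective (cong proj₁ e)) (doubleℤ-injective (cong proj₂ e))

-- GF(2)-polynomials as functionals

open CommutativeSemigroupProperties (CommutativeRing.+-commutativeSemigroup xor-∧-commutativeRing)
  using () renaming (interchange to xor-interchange; x∙yz≈y∙xz to xor-leftComm)

xor-cancelˡ : ∀ x y → x xor (x xor y) ≡ y
xor-cancelˡ x y = trans (sym (xor-assoc x x y)) (cong (_xor y) (xor-same x))

xor≡false⇒≡ : ∀ {x y} → x xor y ≡ false → x ≡ y
xor≡false⇒≡ {x} {y} e = sym (trans (sym (xor-cancelˡ x y)) (trans (cong (x xor_) e) (xor-identityʳ x)))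

infix 4 _≈_

⟪_∣_⟫ : Poly → (Cell → Bool) → Bool
⟪ [] ∣ g ⟫ = false
⟪ v ∷ P ∣ g ⟫ = g v xor ⟪ P ∣ g ⟫

-- Pairing against every g, not only against indicators of single cells,
-- makes _≈_ a congruence for _*P_ directly.
record _≈_ (P Q : Poly) : Set where
  constructor pairing≡
  field ⟪⟫≡ : ∀ g → ⟪ P ∣ g ⟫ ≡ ⟪ Q ∣ g ⟫
open _≈_

≈-setoid : Setoid 0ℓ 0ℓ
≈-setoid = record
  { Carrier = Poly
  ; _≈_ = _≈_
  ; isEquivalence = record
    { refl = pairing≡ λ g → refl
    ; sym = λ e → pairing≡ λ g → sym (⟪⟫≡ e g)
    ; trans = λ e f → pairing≡ λ g → trans (⟪⟫≡ e g) (⟪⟫≡ f g)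
    }
  }

open Setoid ≈-setoid using () renaming (refl to ≈-refl; sym to ≈-sym; trans to ≈-trans)

module ≈-Reasoning = SetoidReasoning ≈-setoid

⟪⟫-cong : ∀ P {g h} → (∀ u → g u ≡ h u) → ⟪ P ∣ g ⟫ ≡ ⟪ P ∣ h ⟫
⟪⟫-cong [] e = refl
⟪⟫-cong (v ∷ P) e = cong₂ _xor_ (e v) (⟪⟫-cong P e)

⟪⟫-++ : ∀ P Q g → ⟪ P ++ Q ∣ g ⟫ ≡ ⟪ P ∣ g ⟫ xor ⟪ Q ∣ g ⟫
⟪⟫-++ [] Q g = refl
⟪⟫-++ (v ∷ P) Q g = trans (cong (g v xor_) (⟪⟫-++ P Q g)) (sym (xor-assoc (g v) _ _))

⟪⟫-map : ∀ f P g → ⟪ map f P ∣ g ⟫ ≡ ⟪ P ∣ g ∘ f ⟫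
⟪⟫-map f [] g = refl
⟪⟫-map f (v ∷ P) g = cong (g (f v) xor_) (⟪⟫-map f P g)

⟪⟫-xor : ∀ P g h → ⟪ P ∣ (λ u → g u xor h u) ⟫ ≡ ⟪ P ∣ g ⟫ xor ⟪ P ∣ h ⟫
⟪⟫-xor [] g h = refl
⟪⟫-xor (v ∷ P) g h = trans (cong ((g v xor h v) xor_) (⟪⟫-xor P g h)) (xor-interchange (g v) (h v) _ _)

⟪⟫-*P : ∀ P Q g → ⟪ P *P Q ∣ g ⟫ ≡ ⟪ P ∣ (λ p → ⟪ Q ∣ (λ q → g (p +ᶜ q)) ⟫) ⟫
⟪⟫-*P [] Q g = refl
⟪⟫-*P (v ∷ P) Q g = trans (⟪⟫-++ (map (v +ᶜ_) Q) (P *P Q) g) (cong₂ _xor_ (⟪⟫-map (v +ᶜ_) Q g) (⟪⟫-*P P Q g))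

++-cong : ∀ {P P′ Q Q′} → P ≈ P′ → Q ≈ Q′ → P ++ Q ≈ P′ ++ Q′
++-cong {P} {P′} {Q} {Q′} eP eQ = pairing≡ λ g →
  trans (⟪⟫-++ P Q g) (trans (cong₂ _xor_ (⟪⟫≡ eP g) (⟪⟫≡ eQ g)) (sym (⟪⟫-++ P′ Q′ g)))

map-cong : ∀ f {P Q} → P ≈ Q → map f P ≈ map f Q
map-cong f {P} {Q} e = pairing≡ λ g → trans (⟪⟫-map f P g) (trans (⟪⟫≡ e (g ∘ f)) (sym (⟪⟫-map f Q g)))

*P-congʳ : ∀ P {Q Q′} → Q ≈ Q′ → P *P Q ≈ P *P Q′
*P-congʳ P {Q} {Q′} e = pairing≡ λ g →
  trans (⟪⟫-*P P Q g) (trans (⟪⟫-cong P (λ p → ⟪⟫≡ e _)) (sym (⟪⟫-*P P Q′ g)))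

*P-congˡ : ∀ {P P′} Q → P ≈ P′ → P *P Q ≈ P′ *P Q
*P-congˡ {P} {P′} Q e = pairing≡ λ g → trans (⟪⟫-*P P Q g) (trans (⟪⟫≡ e _) (sym (⟪⟫-*P P′ Q g)))

*P-assoc : ∀ P Q R → (P *P Q) *P R ≈ P *P (Q *P R)
*P-assoc P Q R = pairing≡ λ g → let open ≡-Reasoning in begin
  ⟪ (P *P Q) *P R ∣ g ⟫
    ≡⟨ ⟪⟫-*P (P *P Q) R g ⟩
  ⟪ P *P Q ∣ (λ s → ⟪ R ∣ (λ r → g (s +ᶜ r)) ⟫) ⟫
    ≡⟨ ⟪⟫-*P P Q _ ⟩
  ⟪ P ∣ (λ p → ⟪ Q ∣ (λ q → ⟪ R ∣ (λ r → g (p +ᶜ q +ᶜ r)) ⟫) ⟫) ⟫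
    ≡⟨ ⟪⟫-cong P (λ p → ⟪⟫-cong Q (λ q → ⟪⟫-cong R (λ r → cong g (+ᶜ-assoc p q r)))) ⟩
  ⟪ P ∣ (λ p → ⟪ Q ∣ (λ q → ⟪ R ∣ (λ r → g (p +ᶜ (q +ᶜ r))) ⟫) ⟫) ⟫
    ≡⟨ ⟪⟫-cong P (λ p → sym (⟪⟫-*P Q R _)) ⟩
  ⟪ P ∣ (λ p → ⟪ Q *P R ∣ (λ t → g (p +ᶜ t)) ⟫) ⟫
    ≡⟨ sym (⟪⟫-*P P (Q *P R) g) ⟩
  ⟪ P *P (Q *P R) ∣ g ⟫ ∎

*P-identityˡ : ∀ P → one *P P ≈ P
*P-identityˡ P = pairing≡ λ g →
  trans (⟪⟫-*P one P g) (trans (xor-identityʳ _) (⟪⟫-cong P (λ q → cong g (+ᶜ-identityˡ q))))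

*P-distribʳ-++ : ∀ P Q R → (P ++ Q) *P R ≈ P *P R ++ Q *P R
*P-distribʳ-++ P Q R = pairing≡ λ g → let h = λ p → ⟪ R ∣ (λ r → g (p +ᶜ r)) ⟫ in begin
  ⟪ (P ++ Q) *P R ∣ g ⟫                  ≡⟨ ⟪⟫-*P (P ++ Q) R g ⟩
  ⟪ P ++ Q ∣ h ⟫                         ≡⟨ ⟪⟫-++ P Q h ⟩
  ⟪ P ∣ h ⟫ xor ⟪ Q ∣ h ⟫                ≡⟨ sym (cong₂ _xor_ (⟪⟫-*P P R g) (⟪⟫-*P Q R g)) ⟩
  ⟪ P *P R ∣ g ⟫ xor ⟪ Q *P R ∣ g ⟫      ≡⟨ sym (⟪⟫-++ (P *P R) (Q *P R) g) ⟩
  ⟪ P *P R ++ Q *P R ∣ g ⟫               ∎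
  where open ≡-Reasoning

^P-+ : ∀ P m n → P ^P (m + n) ≈ (P ^P m) *P (P ^P n)
^P-+ P zero n = ≈-sym (*P-identityˡ (P ^P n))
^P-+ P (suc m) n = ≈-trans (*P-congʳ P (^P-+ P m n)) (≈-sym (*P-assoc P (P ^P m) (P ^P n)))

shift : Cell → Poly → Poly
shift c = map (c +ᶜ_)

dilate : Poly → Poly
dilate = map double

shift-*P : ∀ c P Q → shift c P *P Q ≈ shift c (P *P Q)
shift-*P c P Q = pairing≡ λ g → begin
  ⟪ shift c P *P Q ∣ g ⟫
    ≡⟨ ⟪⟫-*P (shift c P) Q g ⟩
  ⟪ shift c P ∣ (λ p → ⟪ Q ∣ (λ q → g (p +ᶜ q)) ⟫) ⟫
    ≡⟨ ⟪⟫-map (c +ᶜ_) P _ ⟩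
  ⟪ P ∣ (λ p → ⟪ Q ∣ (λ q → g (c +ᶜ p +ᶜ q)) ⟫) ⟫
    ≡⟨ ⟪⟫-cong P (λ p → ⟪⟫-cong Q (λ q → cong g (+ᶜ-assoc c p q))) ⟩
  ⟪ P ∣ (λ p → ⟪ Q ∣ (λ q → g (c +ᶜ (p +ᶜ q))) ⟫) ⟫
    ≡⟨ sym (⟪⟫-*P P Q (g ∘ (c +ᶜ_))) ⟩
  ⟪ P *P Q ∣ g ∘ (c +ᶜ_) ⟫
    ≡⟨ sym (⟪⟫-map (c +ᶜ_) (P *P Q) g) ⟩
  ⟪ shift c (P *P Q) ∣ g ⟫ ∎
  where open ≡-Reasoning

dilate-*P : ∀ P Q → dilate (P *P Q) ≈ dilate P *P dilate Q
dilate-*P P Q = pairing≡ λ g → begin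
  ⟪ dilate (P *P Q) ∣ g ⟫
    ≡⟨ ⟪⟫-map double (P *P Q) g ⟩
  ⟪ P *P Q ∣ g ∘ double ⟫
    ≡⟨ ⟪⟫-*P P Q (g ∘ double) ⟩
  ⟪ P ∣ (λ p → ⟪ Q ∣ (λ q → g (double (p +ᶜ q))) ⟫) ⟫
    ≡⟨ ⟪⟫-cong P (λ p → ⟪⟫-cong Q (λ q → cong g (double-+ᶜ p q))) ⟩
  ⟪ P ∣ (λ p → ⟪ Q ∣ (λ q → g (double p +ᶜ double q)) ⟫) ⟫
    ≡⟨ sym (⟪⟫-cong P (λ p → ⟪⟫-map double Q _)) ⟩
  ⟪ P ∣ (λ p → ⟪ dilate Q ∣ (λ q → g (double p +ᶜ q)) ⟫) ⟫
    ≡⟨ sym (⟪⟫-map double P _) ⟩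
  ⟪ dilate P ∣ (λ p → ⟪ dilate Q ∣ (λ q → g (p +ᶜ q)) ⟫) ⟫
    ≡⟨ sym (⟪⟫-*P (dilate P) (dilate Q) g) ⟩
  ⟪ dilate P *P dilate Q ∣ g ⟫ ∎
  where open ≡-Reasoning

-- The cross terms p q and q p cancel in characteristic 2.
*P-self : ∀ P → P *P P ≈ dilate P
*P-self P = pairing≡ λ g →
  trans (⟪⟫-*P P P g) (trans (diagonal g P) (sym (⟪⟫-map double P g)))
  where
  diagonal : ∀ g A → ⟪ A ∣ (λ p → ⟪ A ∣ (λ q → g (p +ᶜ q)) ⟫) ⟫ ≡ ⟪ A ∣ g ∘ double ⟫
  diagonal g [] = refl
  diagonal g (a ∷ A) = begin
    (g (double a) xor row) xor ⟪ A ∣ (λ p → g (p +ᶜ a) xor ⟪ A ∣ (λ q → g (p +ᶜ q)) ⟫) ⟫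
      ≡⟨ cong ((g (double a) xor row) xor_) (⟪⟫-xor A _ _) ⟩
    (g (double a) xor row) xor (⟪ A ∣ (λ p → g (p +ᶜ a)) ⟫ xor rest)
      ≡⟨ cong (λ column → (g (double a) xor row) xor (column xor rest))
              (⟪⟫-cong A (λ p → cong g (+ᶜ-comm p a))) ⟩
    (g (double a) xor row) xor (row xor rest)
      ≡⟨ xor-assoc (g (double a)) row _ ⟩
    g (double a) xor (row xor (row xor rest))
      ≡⟨ cong (g (double a) xor_) (xor-cancelˡ row rest) ⟩
    g (double a) xor rest
      ≡⟨ cong (g (double a) xor_) (diagonal g A) ⟩
    g (double a) xor ⟪ A ∣ g ∘ double ⟫ ∎
    where
    open ≡-Reasoning
    row rest : Bool
    row = ⟪ A ∣ (λ q → g (a +ᶜ q)) ⟫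
    rest = ⟪ A ∣ (λ p → ⟪ A ∣ (λ q → g (p +ᶜ q)) ⟫) ⟫

^P-odd : ∀ P k → P ^P suc (k + k) ≈ P *P dilate (P ^P k)
^P-odd P k = *P-congʳ P (≈-trans (^P-+ P k k) (*P-self (P ^P k)))

toggle : Cell → Poly → Poly
toggle u [] = u ∷ []
toggle u (v ∷ P) with u ≟c v
... | yes _ = P
... | no _ = v ∷ toggle u P

cancelPairs : Poly → Poly
cancelPairs [] = []
cancelPairs (u ∷ P) = toggle u (cancelPairs P)

toggle-≈ : ∀ u P → toggle u P ≈ u ∷ P
toggle-≈ u [] = ≈-refl
toggle-≈ u (v ∷ P) with u ≟c v
... | yes refl = pairing≡ λ g → sym (xor-cancelˡ (g u) _)
... | no _ = pairing≡ λ g →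
  trans (cong (g v xor_) (⟪⟫≡ (toggle-≈ u P) g)) (xor-leftComm (g v) (g u) _)

cancelPairs-≈ : ∀ P → cancelPairs P ≈ P
cancelPairs-≈ [] = ≈-refl
cancelPairs-≈ (u ∷ P) =
  ≈-trans (toggle-≈ u (cancelPairs P)) (pairing≡ λ g → cong (g u xor_) (⟪⟫≡ (cancelPairs-≈ P) g))

-- Decides _≈_ between explicit polynomials: the hypothesis holds by computation.
≈-by-cancelPairs : ∀ P Q → cancelPairs (P ++ Q) ≡ [] → P ≈ Q
≈-by-cancelPairs P Q e = pairing≡ λ g → xor≡false⇒≡
  (trans (sym (⟪⟫-++ P Q g)) (trans (sym (⟪⟫≡ (cancelPairs-≈ (P ++ Q)) g)) (cong ⟪_∣ g ⟫ e)))

-- Counting monomials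

coeff-++ : ∀ P Q u → coeff (P ++ Q) u ≡ coeff P u xor coeff Q u
coeff-++ [] Q u = refl
coeff-++ (v ∷ P) Q u = trans (cong (does (v ≟c u) xor_) (coeff-++ P Q u)) (sym (xor-assoc (does (v ≟c u)) _ _))

coeff≡⟪⟫ : ∀ P u → coeff P u ≡ ⟪ P ∣ (λ v → does (v ≟c u)) ⟫
coeff≡⟪⟫ [] u = refl
coeff≡⟪⟫ (v ∷ P) u = cong (does (v ≟c u) xor_) (coeff≡⟪⟫ P u)

coeff-resp-≈ : ∀ {P Q} → P ≈ Q → ∀ u → coeff P u ≡ coeff Q u
coeff-resp-≈ {P} {Q} e u = trans (coeff≡⟪⟫ P u) (trans (⟪⟫≡ e _) (sym (coeff≡⟪⟫ Q u)))

coeff≡true⇒∈ : ∀ P {u} → coeff P u ≡ true → u ∈ P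
coeff≡true⇒∈ (v ∷ P) {u} e with v ≟c u
... | yes refl = here refl
... | no _ = there (coeff≡true⇒∈ P e)

∉⇒coeff≡false : ∀ P {u} → u ∉ P → coeff P u ≡ false
∉⇒coeff≡false P {u} u∉P with coeff P u in e
... | true = contradiction (coeff≡true⇒∈ P e) u∉P
... | false = refl

support-unique : ∀ P → Unique (support P)
support-unique P = Unique.filter⁺ _ (deduplicate-! P)

∈-support : ∀ P {u} → u ∈ support P ⇔ coeff P u ≡ true
∈-support P = mk⇔
  (λ u∈ → proj₂ (∈-filter⁻ _ {xs = deduplicate _≟c_ P} u∈))
  (λ e → ∈-filter⁺ _ (∈-deduplicate⁺ _≟c_ (coeff≡true⇒∈ P e)) e)

-- The support is determined, up to order, by its members.
∣∣≡length : ∀ P {L} → Unique L → (∀ {u} → u ∈ L ⇔ coeff P u ≡ true) → ∣ P ∣P ≡ length L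
∣∣≡length P {L} L-unique ∈L = ↭-length (∼bag⇒↭ (unique∧set⇒bag (support-unique P) L-unique
  (mk⇔ (Equivalence.from ∈L ∘ Equivalence.to (∈-support P))
       (Equivalence.from (∈-support P) ∘ Equivalence.to ∈L))))

∣∣-resp-≈ : ∀ {P Q} → P ≈ Q → ∣ P ∣P ≡ ∣ Q ∣P
∣∣-resp-≈ {P} {Q} e = sym (∣∣≡length Q (support-unique P) (λ {u} → mk⇔
  (λ u∈ → trans (sym (coeff-resp-≈ e u)) (Equivalence.to (∈-support P) u∈))
  (λ c → Equivalence.from (∈-support P) (trans (coeff-resp-≈ e u) c))))

module _ {f : Cell → Cell} (f-injective : ∀ {u v} → f u ≡ f v → u ≡ v) where

  coeff-map : ∀ P v → coeff (map f P) (f v) ≡ coeff P v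
  coeff-map P v = trans (coeff≡⟪⟫ (map f P) (f v))
    (trans (⟪⟫-map f P _) (trans (⟪⟫-cong P does-f) (sym (coeff≡⟪⟫ P v))))
    where
    does-f : ∀ w → does (f w ≟c f v) ≡ does (w ≟c v)
    does-f w with w ≟c v
    ... | yes w≡v = dec-true (f w ≟c f v) (cong f w≡v)
    ... | no w≢v = dec-false (f w ≟c f v) (w≢v ∘ f-injective)

  ∣map∣ : ∀ P → ∣ map f P ∣P ≡ ∣ P ∣P
  ∣map∣ P = trans (∣∣≡length (map f P) (Unique.map⁺ f-injective (support-unique P)) (mk⇔ to from))
                  (length-map f (support P))
    where
    to : ∀ {u} → u ∈ map f (support P) → coeff (map f P) u ≡ true
    to u∈ with ∈-map⁻ f u∈
    ... | v , v∈ , refl = trans (coeff-map P v) (Equivalence.to (∈-support P) v∈)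
    from : ∀ {u} → coeff (map f P) u ≡ true → u ∈ map f (support P)
    from c with ∈-map⁻ f (coeff≡true⇒∈ (map f P) c)
    ... | v , _ , refl = ∈-map⁺ f (Equivalence.from (∈-support P) (trans (sym (coeff-map P v)) c))

∣++∣ : ∀ P Q → Disjoint P Q → ∣ P ++ Q ∣P ≡ ∣ P ∣P + ∣ Q ∣P
∣++∣ P Q P#Q = trans
  (∣∣≡length (P ++ Q) (Unique.++⁺ (support-unique P) (support-unique Q) supports-disjoint) (mk⇔ to from))
  (length-++ (support P))
  where
  inP : ∀ {u} → u ∈ support P → coeff P u ≡ true
  inP = Equivalence.to (∈-support P)
  inQ : ∀ {u} → u ∈ support Q → coeff Q u ≡ true
  inQ = Equivalence.to (∈-support Q)
  supports-disjoint : Disjoint (support P) (support Q)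
  supports-disjoint (u∈P , u∈Q) = P#Q (coeff≡true⇒∈ P (inP u∈P) , coeff≡true⇒∈ Q (inQ u∈Q))
  to : ∀ {u} → u ∈ support P ++ support Q → coeff (P ++ Q) u ≡ true
  to {u} u∈ with ∈-++⁻ (support P) u∈
  ... | inj₁ u∈P = trans (coeff-++ P Q u) (cong₂ _xor_ (inP u∈P)
        (∉⇒coeff≡false Q (λ u∈Q → P#Q (coeff≡true⇒∈ P (inP u∈P) , u∈Q))))
  ... | inj₂ u∈Q = trans (coeff-++ P Q u) (cong₂ _xor_
        (∉⇒coeff≡false P (λ u∈P → P#Q (u∈P , coeff≡true⇒∈ Q (inQ u∈Q)))) (inQ u∈Q))
  from : ∀ {u} → coeff (P ++ Q) u ≡ true → u ∈ support P ++ support Q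
  from {u} c with coeff P u in eP | coeff Q u in eQ
  ... | true | _ = ∈-++⁺ˡ (Equivalence.from (∈-support P) eP)
  ... | false | true = ∈-++⁺ʳ (support P) (Equivalence.from (∈-support Q) eQ)
  ... | false | false with () ← trans (sym c) (trans (coeff-++ P Q u) (cong₂ _xor_ eP eQ))

∣shift∣ : ∀ c P → ∣ shift c P ∣P ≡ ∣ P ∣P
∣shift∣ c = ∣map∣ (+ᶜ-cancelˡ c)

∣dilate∣ : ∀ P → ∣ dilate P ∣P ≡ ∣ P ∣P
∣dilate∣ = ∣map∣ double-injective

-- Parity classes

i+i≢1 : ∀ i → i +ℤ i ≢ + 1
i+i≢1 (+ zero) ()
i+i≢1 (+ suc n) e with () ← trans (sym (+-suc n n)) (suc-injective (ℤ.+-injective e))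
i+i≢1 -[1+ n ] ()

odd≢even : ∀ v w → + 1 +ℤ (v +ℤ v) ≢ w +ℤ w
odd≢even v w e = i+i≢1 (w - v) (trans (halve w v) (trans (cong (_- (v +ℤ v)) (sym e)) (cancel v)))
  where
  halve : ∀ w v → (w - v) +ℤ (w - v) ≡ (w +ℤ w) - (v +ℤ v)
  halve = solveℤ-∀
  cancel : ∀ v → (+ 1 +ℤ (v +ℤ v)) - (v +ℤ v) ≡ + 1
  cancel = solveℤ-∀

Parity : Set
Parity = Bool × Bool

parities : List Parity
parities = (false , false) ∷ (true , false) ∷ (false , true) ∷ (true , true) ∷ []

parities-unique : Unique parities
parities-unique = ((λ ()) ∷ (λ ()) ∷ (λ ()) ∷ []) ∷ ((λ ()) ∷ (λ ()) ∷ []) ∷ ((λ ()) ∷ []) ∷ [] ∷ []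

bit : Bool → ℤ
bit false = + 0
bit true = + 1

bit-injective : ∀ p q v w → bit p +ℤ (v +ℤ v) ≡ bit q +ℤ (w +ℤ w) → p ≡ q
bit-injective false false v w e = refl
bit-injective true true v w e = refl
bit-injective true false v w e = contradiction (trans e (ℤ.+-identityˡ _)) (odd≢even v w)
bit-injective false true v w e = contradiction (trans (sym e) (ℤ.+-identityˡ _)) (odd≢even w v)

representative : Parity → Cell
representative (p , q) = bit p , bit q

_HasParity_ : Cell → Parity → Set
u HasParity κ = ∃[ v ] u ≡ representative κ +ᶜ double v

parity-unique : ∀ {u κ κ′} → u HasParity κ → u HasParity κ′ → κ ≡ κ′
parity-unique {κ = p , q} {κ′ = p′ , q′} (v , refl) (w , e) =
  cong₂ _,_ (bit-injective p p′ (proj₁ v) (proj₁ w) (cong proj₁ e))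
            (bit-injective q q′ (proj₂ v) (proj₂ w) (cong proj₂ e))

piece : Parity → Cell → Poly → Poly
piece κ t R = shift (representative κ +ᶜ double t) (dilate R)

piece-parity : ∀ κ t R {u} → u ∈ piece κ t R → u HasParity κ
piece-parity κ t R u∈ with ∈-map⁻ (representative κ +ᶜ double t +ᶜ_) u∈
... | _ , w∈ , refl with ∈-map⁻ double w∈
... | w , _ , refl = t +ᶜ w , (begin
  representative κ +ᶜ double t +ᶜ double w   ≡⟨ +ᶜ-assoc (representative κ) (double t) (double w) ⟩
  representative κ +ᶜ (double t +ᶜ double w) ≡⟨ cong (representative κ +ᶜ_) (sym (double-+ᶜ t w)) ⟩
  representative κ +ᶜ double (t +ᶜ w)        ∎)
  where open ≡-Reasoning

∣piece∣ : ∀ κ t R → ∣ piece κ t R ∣P ≡ ∣ R ∣P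
∣piece∣ κ t R = trans (∣shift∣ (representative κ +ᶜ double t) (dilate R)) (∣dilate∣ R)

piece-*P : ∀ κ t R P → piece κ t R *P dilate P ≈ piece κ t (R *P P)
piece-*P κ t R P = ≈-trans (shift-*P c (dilate R) (dilate P)) (map-cong (c +ᶜ_) (≈-sym (dilate-*P R P)))
  where c = representative κ +ᶜ double t

module _ {I : Set} (A : I → Poly) where

  concatMap-*P : ∀ is R → concatMap A is *P R ≈ concatMap (λ i → A i *P R) is
  concatMap-*P [] R = ≈-refl
  concatMap-*P (i ∷ is) R =
    ≈-trans (*P-distribʳ-++ (A i) (concatMap A is) R) (++-cong ≈-refl (concatMap-*P is R))

  module _ (A-disjoint : ∀ {i j} → i ≢ j → Disjoint (A i) (A j)) where

    disjoint-concatMap : ∀ {i is} → All (i ≢_) is → Disjoint (A i) (concatMap A is)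
    disjoint-concatMap {is = j ∷ is} (i≢j ∷ i∉is) (u∈Ai , u∈) with ∈-++⁻ (A j) u∈
    ... | inj₁ u∈Aj = A-disjoint i≢j (u∈Ai , u∈Aj)
    ... | inj₂ u∈rest = disjoint-concatMap i∉is (u∈Ai , u∈rest)

    ∣concatMap∣ : ∀ {is} → Unique is → ∣ concatMap A is ∣P ≡ sum (map (λ i → ∣ A i ∣P) is)
    ∣concatMap∣ [] = refl
    ∣concatMap∣ {i ∷ is} (i∉is ∷ is-unique) =
      trans (∣++∣ (A i) (concatMap A is) (disjoint-concatMap i∉is))
            (cong (_+_ ∣ A i ∣P) (∣concatMap∣ is-unique))

concatMap-cong : ∀ {I : Set} {A B : I → Poly} → (∀ i → A i ≈ B i) → ∀ is → concatMap A is ≈ concatMap B is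
concatMap-cong e [] = ≈-refl
concatMap-cong e (i ∷ is) = ++-cong (e i) (concatMap-cong e is)

record ParityDecomposition (Q : Poly) : Set where
  field
    offset : Parity → Cell
    part : Parity → Poly
    decomposes : Q ≈ concatMap (λ κ → piece κ (offset κ) (part κ)) parities

module _ {Q : Poly} (D : ParityDecomposition Q) where
  open ParityDecomposition D

  product-pieces : Poly → Parity → Poly
  product-pieces P κ = piece κ (offset κ) (part κ *P P)

  *P-dilate-≈ : ∀ P → Q *P dilate P ≈ concatMap (product-pieces P) parities
  *P-dilate-≈ P = begin
    Q *P dilate P
      ≈⟨ *P-congˡ (dilate P) decomposes ⟩
    concatMap summands parities *P dilate P
      ≈⟨ concatMap-*P summands parities (dilate P) ⟩
    concatMap (λ κ → summands κ *P dilate P) parities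
      ≈⟨ concatMap-cong (λ κ → piece-*P κ (offset κ) (part κ) P) parities ⟩
    concatMap (product-pieces P) parities ∎
    where
    open ≈-Reasoning
    summands : Parity → Poly
    summands κ = piece κ (offset κ) (part κ)

  ∣*P-dilate∣ : ∀ P → ∣ Q *P dilate P ∣P ≡ sum (map (λ κ → ∣ part κ *P P ∣P) parities)
  ∣*P-dilate∣ P = begin
    ∣ Q *P dilate P ∣P
      ≡⟨ ∣∣-resp-≈ (*P-dilate-≈ P) ⟩
    ∣ concatMap (product-pieces P) parities ∣P
      ≡⟨ ∣concatMap∣ (product-pieces P) pieces-disjoint parities-unique ⟩
    sum (map (λ κ → ∣ product-pieces P κ ∣P) parities)
      ≡⟨ cong sum (map-cong-≡ (λ κ → ∣piece∣ κ (offset κ) (part κ *P P)) parities) ⟩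
    sum (map (λ κ → ∣ part κ *P P ∣P) parities) ∎
    where
    open ≡-Reasoning
    pieces-disjoint : ∀ {κ κ′} → κ ≢ κ′ → Disjoint (product-pieces P κ) (product-pieces P κ′)
    pieces-disjoint {κ} {κ′} κ≢κ′ (u∈ , u∈′) = κ≢κ′ (parity-unique
      (piece-parity κ (offset κ) (part κ *P P) u∈) (piece-parity κ′ (offset κ′) (part κ′ *P P) u∈′))

-- The counts along F^(2^n - 1)

X Y : Poly
X = 0ᶜ ∷ (+ 1 , + 0) ∷ []
Y = 0ᶜ ∷ (+ 0 , + 1) ∷ []

F-decomposition : ParityDecomposition (one *P F)
F-decomposition = record
  { offset = λ where
      (true , false) → -[1+ 0 ] , + 0
      (false , true) → + 0 , -[1+ 0 ]
      _ → 0ᶜ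
  ; part = λ where
      (false , false) → one
      (true , false) → X
      (false , true) → Y
      (true , true) → []
  ; decomposes = ≈-by-cancelPairs _ _ refl
  }

-- (1 + x) F = x⁻¹ + x² + y⁻¹ + y + x y⁻¹ + x y
XF-decomposition : ParityDecomposition (X *P F)
XF-decomposition = record
  { offset = λ where
      (false , false) → + 1 , + 0
      (true , false) → -[1+ 0 ] , + 0
      _ → + 0 , -[1+ 0 ]
  ; part = λ where
      (false , true) → Y
      (true , true) → Y
      _ → one
  ; decomposes = ≈-by-cancelPairs _ _ refl
  }

-- (1 + y) F = y⁻¹ + y² + x⁻¹ + x + x⁻¹ y + x y
YF-decomposition : ParityDecomposition (Y *P F)
YF-decomposition = record
  { offset = λ where
      (false , false) → + 0 , + 1
      (false , true) → + 0 , -[1+ 0 ]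
      _ → -[1+ 0 ] , + 0
  ; part = λ where
      (true , false) → X
      (true , true) → X
      _ → one
  ; decomposes = ≈-by-cancelPairs _ _ refl
  }

G : ℕ → Poly
G n = F ^P (2 ^ n ∸ 1)

2*m∸1 : ∀ m .{{_ : NonZero m}} → 2 * m ∸ 1 ≡ suc ((m ∸ 1) + (m ∸ 1))
2*m∸1 (suc k) = trans (cong (_+_ k) (+-identityʳ (suc k))) (+-suc k k)

G-suc : ∀ n → G (suc n) ≈ F *P dilate (G n)
G-suc n = subst (λ m → F ^P m ≈ F *P dilate (G n)) (sym (2*m∸1 (2 ^ n) {{m^n≢0 2 n}}))
                (^P-odd F (2 ^ n ∸ 1))

count : Poly → ℕ → ℕ
count R n = ∣ R *P G n ∣P

b≡count-one : ∀ n → b n ≡ count one n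
b≡count-one n = sym (∣∣-resp-≈ (*P-identityˡ (G n)))

count-suc : ∀ R (D : ParityDecomposition (R *P F)) n → let open ParityDecomposition D in
            count R (suc n) ≡ count (part (false , false)) n + count (part (true , false)) n
                              + count (part (false , true)) n + count (part (true , true)) n
count-suc R D n =
  trans (∣∣-resp-≈ R*G≈RF*G)
        (trans (∣*P-dilate∣ D (G n))
               (sum-of-four (count-part (false , false)) (count-part (true , false))
                            (count-part (false , true)) (count-part (true , true))))
  where
  R*G≈RF*G : R *P G (suc n) ≈ (R *P F) *P dilate (G n)
  R*G≈RF*G = ≈-trans (*P-congʳ R (G-suc n)) (≈-sym (*P-assoc R F (dilate (G n))))
  count-part : Parity → ℕ
  count-part κ = count (ParityDecomposition.part D κ) n
  sum-of-four : ∀ a b c d → a + (b + (c + (d + 0))) ≡ a + b + c + d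
  sum-of-four = solve-∀

-- The class (1, 1) of F is empty, hence the + 0 terms.
eliminate : ∀ {b₀ c₀ d₀ b₁ c₁ d₁ b₂ : ℕ} →
            b₁ ≡ b₀ + c₀ + d₀ + 0 → c₁ ≡ b₀ + b₀ + d₀ + d₀ → d₁ ≡ b₀ + c₀ + b₀ + c₀ →
            b₂ ≡ b₁ + c₁ + d₁ + 0 → b₂ ≡ 3 * b₁ + 2 * b₀
eliminate {b₀} {c₀} {d₀} refl refl refl refl = linear b₀ c₀ d₀
  where
  linear : ∀ b₀ c₀ d₀ → let b₁ = b₀ + c₀ + d₀ + 0 in
           b₁ + (b₀ + b₀ + d₀ + d₀) + (b₀ + c₀ + b₀ + c₀) + 0 ≡ 3 * b₁ + 2 * b₀
  linear = solve-∀

theorem5 : (b 0 ≡ 1) × (b 1 ≡ 5) × (∀ (n : ℕ) → b (suc (suc n)) ≡ 3 * b (suc n) + 2 * b n)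
theorem5 = refl , refl , λ n → begin
  b (2 + n)
    ≡⟨ b≡count-one (2 + n) ⟩
  count one (2 + n)
    ≡⟨ eliminate {count one n} {count X n} {count Y n}
                 {count one (1 + n)} {count X (1 + n)} {count Y (1 + n)}
                 (count-suc one F-decomposition n) (count-suc X XF-decomposition n)
                 (count-suc Y YF-decomposition n) (count-suc one F-decomposition (1 + n)) ⟩
  3 * count one (1 + n) + 2 * count one n
    ≡⟨ sym (cong₂ (λ p q → 3 * p + 2 * q) (b≡count-one (1 + n)) (b≡count-one n)) ⟩
  3 * b (1 + n) + 2 * b n ∎
  where open ≡-Reasoning
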